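{- For every Boolean function $f$ on variables $\mathbf{x}$, the function $h_f$ is a Horn function (i.e. it can be represented by a CNF all of whose clauses contain at most one positive literal).
   Context: A partial assignment $\alpha$ of $\mathbf{x}$ is a set of literals on $\mathbf{x}$ with no complementary pair. The semantic closure is $\mathrm{cl}_{\mathrm{sem}}(f,\alpha)=\{l\text{ literal on }\mathbf{x}\mid f(\mathbf{x})\wedge\alpha\models l\}$. Introduce a meta-variable $\ell_l$ for each literal $l$ on $\mathbf{x}$; an assignment of the meta-variables is identified with the set of literals $\{l\mid\ell_l=1\}$. $S(f)$ is the set of partial assignments $\alpha$ with $\mathrm{cl}_{\mathrm{sem}}(f,\alpha)=\alpha$, and $h_f$ is the characteristic function of $S(f)$, viewed as a Boolean function of the meta-variables. -}

module Defs where

open import Data.Nat using (ℕ; zero; suc; _≤_)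
open import Data.Bool using (Bool; true; false; _∧_; _∨_; not; _xor_)
open import Data.Fin using (Fin)
open import Data.Vec using (Vec; []; _∷_; lookup)
open import Data.List using (List; []; _∷_; [_]; concatMap; map; length; filter)
open import Data.Bool.ListAction using (all; any)
open import Data.List using (allFin)
open import Data.Product using (_×_; _,_; proj₂; Σ-syntax)
open import Relation.Binary.PropositionalEquality using (_≡_)
open import Data.Bool.Properties using (T?)
open import Data.Unit using (⊤)

Assignment : ℕ → Set
Assignment n = Fin n → Bool

BoolFun : ℕ → Set
BoolFun n = Assignment n → Bool

Lit : ℕ → Set
Lit n = Fin n × Bool

litVal : ∀ {n} → Assignment n → Lit n → Bool
litVal x (i , true)  = x i
litVal x (i , false) = not (x i)

compl : ∀ {n} → Lit n → Lit n
compl (i , b) = (i , not b)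

allLits : ∀ n → List (Lit n)
allLits n = concatMap (λ i → (i , true) ∷ (i , false) ∷ []) (allFin n)

allVecs : ∀ n → List (Vec Bool n)
allVecs zero    = [ [] ]
allVecs (suc n) = concatMap (λ v → (true ∷ v) ∷ (false ∷ v) ∷ []) (allVecs n)

allAssignments : ∀ n → List (Assignment n)
allAssignments n = map lookup (allVecs n)

-- Meta level: one meta-variable ℓ_l per literal l on x.  An assignment
-- of the meta-variables β : Lit n → Bool is identified with the set of
-- literals {l | β l = true}.

MetaAssignment : ℕ → Set
MetaAssignment n = Lit n → Bool

satisfiesAll : ∀ {n} → Assignment n → MetaAssignment n → Bool
satisfiesAll {n} x α = all (λ l → not (α l) ∨ litVal x l) (allLits n)

entails : ∀ {n} → BoolFun n → MetaAssignment n → Lit n → Bool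
entails {n} f α l =
  all (λ x → not (f x ∧ satisfiesAll x α) ∨ litVal x l) (allAssignments n)

isPartial : ∀ {n} → MetaAssignment n → Bool
isPartial {n} α = all (λ i → not (α (i , true) ∧ α (i , false))) (allFin n)

-- cl_sem(f, α) = α : for every literal l, (f ∧ α ⊨ l) iff l ∈ α.
isClosed : ∀ {n} → BoolFun n → MetaAssignment n → Bool
isClosed {n} f α = all (λ l → not (entails f α l xor α l)) (allLits n)

-- h_f : characteristic function of S(f) as a Boolean function of the
-- meta-variables.
h : ∀ {n} → BoolFun n → MetaAssignment n → Bool
h f α = isPartial α ∧ isClosed f α

CLit : Set → Set
CLit V = V × Bool

Clause : Set → Set
Clause V = List (CLit V)

CNF : Set → Set
CNF V = List (Clause V)

evalCLit : ∀ {V} → (V → Bool) → CLit V → Bool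
evalCLit β (v , true)  = β v
evalCLit β (v , false) = not (β v)

evalClause : ∀ {V} → (V → Bool) → Clause V → Bool
evalClause β c = any (evalCLit β) c

evalCNF : ∀ {V} → (V → Bool) → CNF V → Bool
evalCNF β φ = all (evalClause β) φ

isHornClause : ∀ {V} → Clause V → Set
isHornClause c = length (filter (λ l → T? (proj₂ l)) c) ≤ 1

isHornCNF : ∀ {V} → CNF V → Set
isHornCNF [] = ⊤
isHornCNF (c ∷ φ) = isHornClause c × isHornCNF φ

IsHornFunction : ∀ {V} → ((V → Bool) → Bool) → Set
IsHornFunction {V} g =
  Σ[ φ ∈ CNF V ] (isHornCNF φ × (∀ β → evalCNF β φ ≡ g β))

-- A set β of literals lies in S(f) iff it has no complementary pair and f ∧ β ⊨ l implies
-- l ∈ β for every literal l (the converse inclusion β ⊆ cl_sem(f, β) always holds).  The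
-- no-complementary-pair condition is the negative clauses ¬ℓ_{x_i} ∨ ¬ℓ_{¬x_i}.  Entailment is
-- monotone in the premise set, so f ∧ β ⊨ l holds iff f ∧ γ ⊨ l for some γ ⊆ β; hence
-- "f ∧ β ⊨ l implies l ∈ β" is the conjunction, over the finitely many γ with f ∧ γ ⊨ l, of
-- the Horn clauses (⋀_{m ∈ γ} ℓ_m) → ℓ_l.
module Submission where

open import Defs
open import Data.Nat using (ℕ; z≤n; s≤s)
open import Data.Bool using (Bool; true; false; T; _∧_; _∨_; not; _xor_)
open import Data.Bool.Properties using (T?; T-≡; T-∧; ⇔→≡; ∨-comm; ∧-assoc; ∧-identityʳ)
  renaming (_≟_ to _≟ᴮ_)
open import Data.Bool.ListAction using (all)
open import Data.Fin.Properties using () renaming (_≟_ to _≟ᶠ_)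
open import Data.List using (List; []; _∷_; [_]; _++_; map; filter; filterᵇ; allFin)
open import Data.List.Membership.Propositional using (_∈_)
open import Data.List.Membership.Propositional.Properties using (∈-++⁺ˡ; ∈-++⁺ʳ; ∈-map⁺; ∈-filter⁺)
import Data.List.Relation.Unary.All as All
open import Data.List.Relation.Unary.All.Properties using (all⁺; all⁻; all-filter)
open import Data.List.Relation.Unary.Any using (here; there)
open import Data.Product using (_,_; proj₂)
open import Data.Product.Properties using (≡-dec)
open import Data.Empty using (⊥-elim)
open import Data.Unit using (tt)
open import Function using (_∘_)
open import Function.Bundles using (_⇔_; mk⇔; Equivalence)
open import Relation.Binary.Definitions using (DecidableEquality)
open import Relation.Binary.PropositionalEquality using (_≡_; refl; sym; trans; cong; cong₂)
open import Relation.Nullary.Decidable using (does; isYes; toWitness; fromWitness)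
open import Relation.Unary using (Pred; Decidable)
open import Level using (0ℓ)
import Data.List.Membership.DecPropositional as DecMembership

open Equivalence using (to; from)

T-injective : ∀ {a b} → T a ⇔ T b → a ≡ b
T-injective e = ⇔→≡ (mk⇔ (to T-≡ ∘ to e ∘ from T-≡) (to T-≡ ∘ from e ∘ from T-≡))

T-→ : ∀ {a b} → T (not a ∨ b) ⇔ (T a → T b)
T-→ {false} = mk⇔ (λ _ ()) _
T-→ {true}  = mk⇔ (λ b _ → b) (λ f → f tt)

T-all-→ : ∀ {A : Set} (p q : A → Bool) xs →
          T (all (λ x → not (p x) ∨ q x) xs) ⇔ (∀ {x} → x ∈ xs → T (p x) → T (q x))
T-all-→ p q xs = mk⇔
  (λ t {x} x∈xs → to T-→ (All.lookup (all⁺ (λ x → not (p x) ∨ q x) xs t) x∈xs))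
  (λ f → all⁻ (λ x → not (p x) ∨ q x) (All.tabulate (λ {x} x∈xs → from T-→ (f x∈xs))))

all-cong-∈ : ∀ {A : Set} {p q : A → Bool} xs → (∀ {x} → x ∈ xs → p x ≡ q x) →
             all p xs ≡ all q xs
all-cong-∈ []       eq = refl
all-cong-∈ (x ∷ xs) eq = cong₂ _∧_ (eq (here refl)) (all-cong-∈ xs (eq ∘ there))

not-xor≡not-∨ : ∀ {a b} → (T b → T a) → not (a xor b) ≡ not a ∨ b
not-xor≡not-∨ {false} {false} _ = refl
not-xor≡not-∨ {false} {true}  b⇒a = ⊥-elim (b⇒a tt)
not-xor≡not-∨ {true}  {false} _ = refl
not-xor≡not-∨ {true}  {true}  _ = refl

sublists : ∀ {A : Set} → List A → List (List A)
sublists []       = [ [] ]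
sublists (x ∷ xs) = map (x ∷_) (sublists xs) ++ sublists xs

filter∈sublists : ∀ {A : Set} {P : Pred A 0ℓ} (P? : Decidable P) xs → filter P? xs ∈ sublists xs
filter∈sublists P? []       = here refl
filter∈sublists P? (x ∷ xs) with does (P? x)
... | true  = ∈-++⁺ˡ (∈-map⁺ (x ∷_) (filter∈sublists P? xs))
... | false = ∈-++⁺ʳ _ (filter∈sublists P? xs)

module _ {V : Set} where

  negatives : List V → Clause V
  negatives = map (_, false)

  hornRule : List V → V → Clause V
  hornRule body v = (v , true) ∷ negatives body

  evalClause-negatives : ∀ β body → evalClause β (negatives body) ≡ not (all β body)
  evalClause-negatives β []         = refl
  evalClause-negatives β (m ∷ body) rewrite evalClause-negatives β body with β m
  ... | true  = refl
  ... | false = refl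

  evalCNF-singleton : ∀ β (c : Clause V) → evalCNF β [ c ] ≡ evalClause β c
  evalCNF-singleton β c = ∧-identityʳ (evalClause β c)

  evalCNF-++ : ∀ β (φ ψ : CNF V) → evalCNF β (φ ++ ψ) ≡ evalCNF β φ ∧ evalCNF β ψ
  evalCNF-++ β []      ψ = refl
  evalCNF-++ β (c ∷ φ) ψ =
    trans (cong (evalClause β c ∧_) (evalCNF-++ β φ ψ))
          (sym (∧-assoc (evalClause β c) (evalCNF β φ) (evalCNF β ψ)))

  filter-positive-negatives : ∀ body → filter (T? ∘ proj₂) (negatives body) ≡ []
  filter-positive-negatives []         = refl
  filter-positive-negatives (m ∷ body) = filter-positive-negatives body

  isHornClause-hornRule : ∀ body v → isHornClause (hornRule body v)
  isHornClause-hornRule body v rewrite filter-positive-negatives body = s≤s z≤n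

  isHornCNF-++ : ∀ (φ ψ : CNF V) → isHornCNF φ → isHornCNF ψ → isHornCNF (φ ++ ψ)
  isHornCNF-++ []      ψ _          hψ = hψ
  isHornCNF-++ (c ∷ φ) ψ (hc , hφ) hψ = hc , isHornCNF-++ φ ψ hφ hψ

  IsHornFunction-≗ : ∀ {g g′ : (V → Bool) → Bool} → (∀ β → g β ≡ g′ β) →
                     IsHornFunction g → IsHornFunction g′
  IsHornFunction-≗ eq (φ , horn , sem) = φ , horn , λ β → trans (sem β) (eq β)

  IsHornFunction-true : IsHornFunction {V} (λ _ → true)
  IsHornFunction-true = [] , tt , λ _ → refl

  IsHornFunction-∧ : ∀ {g₁ g₂ : (V → Bool) → Bool} → IsHornFunction g₁ → IsHornFunction g₂ →
                     IsHornFunction (λ β → g₁ β ∧ g₂ β)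
  IsHornFunction-∧ (φ , hφ , sφ) (ψ , hψ , sψ) =
    φ ++ ψ , isHornCNF-++ φ ψ hφ hψ , λ β → trans (evalCNF-++ β φ ψ) (cong₂ _∧_ (sφ β) (sψ β))

  IsHornFunction-all : ∀ {X : Set} {g : X → (V → Bool) → Bool} xs →
                       (∀ x → IsHornFunction (g x)) → IsHornFunction (λ β → all (λ x → g x β) xs)
  IsHornFunction-all []       _ = IsHornFunction-true
  IsHornFunction-all (x ∷ xs) H = IsHornFunction-∧ (H x) (IsHornFunction-all xs H)

  IsHornFunction-guarded : ∀ b {g : (V → Bool) → Bool} → IsHornFunction g →
                           IsHornFunction (λ β → not b ∨ g β)
  IsHornFunction-guarded false _ = IsHornFunction-true
  IsHornFunction-guarded true  H = H

  IsHornFunction-rule : ∀ body v → IsHornFunction (λ β → not (all β body) ∨ β v)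
  IsHornFunction-rule body v = [ hornRule body v ] , (isHornClause-hornRule body v , tt) , sem
    where
    sem : ∀ β → evalCNF β [ hornRule body v ] ≡ not (all β body) ∨ β v
    sem β = trans (evalCNF-singleton β (hornRule body v))
              (trans (cong (β v ∨_) (evalClause-negatives β body)) (∨-comm (β v) _))

  IsHornFunction-nand : ∀ u v → IsHornFunction (λ β → not (β u ∧ β v))
  IsHornFunction-nand u v = [ negatives (u ∷ v ∷ []) ] , (z≤n , tt) , sem
    where
    sem : ∀ β → evalCNF β [ negatives (u ∷ v ∷ []) ] ≡ not (β u ∧ β v)
    sem β = trans (evalCNF-singleton β (negatives (u ∷ v ∷ [])))
              (trans (evalClause-negatives β (u ∷ v ∷ []))
                     (cong (λ b → not (β u ∧ b)) (∧-identityʳ (β v))))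

  _⊆[_]_ : (V → Bool) → List V → (V → Bool) → Set
  γ ⊆[ keys ] β = ∀ {m} → m ∈ keys → T (γ m) → T (β m)

  MonotoneOn : List V → ((V → Bool) → Bool) → Set
  MonotoneOn keys E = ∀ {γ β} → γ ⊆[ keys ] β → T (E γ) → T (E β)

module _ {V : Set} (_≟_ : DecidableEquality V) (keys : List V) where

  open DecMembership _≟_ using (_∈?_)

  indicator : List V → V → Bool
  indicator S m = isYes (m ∈? S)

  ⊆-indicator-filterᵇ : ∀ β → β ⊆[ keys ] indicator (filterᵇ β keys)
  ⊆-indicator-filterᵇ β m∈keys βm = fromWitness (∈-filter⁺ (T? ∘ β) m∈keys βm)

  indicator-⊆ : ∀ {β} S → T (all β S) → indicator S ⊆[ keys ] β
  indicator-⊆ {β} S β-S _ m∈S = All.lookup (all⁺ β S β-S) (toWitness m∈S)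

  rulesFrom : ((V → Bool) → Bool) → V → (V → Bool) → Bool
  rulesFrom E v β = all (λ S → not (E (indicator S)) ∨ (not (all β S) ∨ β v)) (sublists keys)

  -- A monotone E holds at β iff it holds at the indicator of β's restriction to the keys,
  -- which is one of the sublists of the keys.
  implication≡rulesFrom : ∀ {E} → MonotoneOn keys E → ∀ v β →
    not (E β) ∨ β v ≡ rulesFrom E v β
  implication≡rulesFrom {E} mono v β = T-injective (mk⇔ sound complete)
    where
    rules : T (rulesFrom E v β) ⇔
            (∀ {S} → S ∈ sublists keys → T (E (indicator S)) → T (not (all β S) ∨ β v))
    rules = T-all-→ (E ∘ indicator) (λ S → not (all β S) ∨ β v) (sublists keys)

    sound : T (not (E β) ∨ β v) → T (rulesFrom E v β)
    sound t = from rules λ {S} _ E-S → from T-→ λ β-S →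
      to T-→ t (mono (indicator-⊆ S β-S) E-S)

    complete : T (rulesFrom E v β) → T (not (E β) ∨ β v)
    complete r = from T-→ λ E-β →
      to T-→ (to rules r (filter∈sublists (T? ∘ β) keys) (mono (⊆-indicator-filterᵇ β) E-β))
             (all⁻ β (all-filter (T? ∘ β) keys))

  IsHornFunction-monotone-implication : ∀ {E} → MonotoneOn keys E → ∀ v →
                                        IsHornFunction (λ β → not (E β) ∨ β v)
  IsHornFunction-monotone-implication {E} mono v =
    IsHornFunction-≗ (sym ∘ implication≡rulesFrom mono v)
      (IsHornFunction-all (sublists keys) λ S →
        IsHornFunction-guarded (E (indicator S)) (IsHornFunction-rule S v))

module _ {n : ℕ} (f : BoolFun n) where

  T-satisfiesAll : ∀ x β → T (satisfiesAll x β) ⇔ (∀ {m} → m ∈ allLits n → T (β m) → T (litVal x m))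
  T-satisfiesAll x β = T-all-→ β (litVal x) (allLits n)

  T-entails : ∀ β l → T (entails f β l) ⇔
              (∀ {x} → x ∈ allAssignments n → T (f x ∧ satisfiesAll x β) → T (litVal x l))
  T-entails β l = T-all-→ (λ x → f x ∧ satisfiesAll x β) (λ x → litVal x l) (allAssignments n)

  satisfiesAll-antitone : ∀ x {γ β} → γ ⊆[ allLits n ] β →
                          T (satisfiesAll x β) → T (satisfiesAll x γ)
  satisfiesAll-antitone x {γ} {β} γ⊆β sat =
    from (T-satisfiesAll x γ) λ m∈ γm → to (T-satisfiesAll x β) sat m∈ (γ⊆β m∈ γm)

  entails-monotone : ∀ l → MonotoneOn (allLits n) (λ γ → entails f γ l)
  entails-monotone l {γ} {β} γ⊆β e = from (T-entails β l) λ {x} x∈ fx∧sat →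
    let fx , sat = to T-∧ fx∧sat in
    to (T-entails γ l) e x∈ (from T-∧ (fx , satisfiesAll-antitone x γ⊆β sat))

  entails-reflexive : ∀ {β l} → l ∈ allLits n → T (β l) → T (entails f β l)
  entails-reflexive {β} {l} l∈ βl = from (T-entails β l) λ {x} _ fx∧sat →
    to (T-satisfiesAll x β) (proj₂ (to T-∧ fx∧sat)) l∈ βl

  isClosed≡ : ∀ β → isClosed f β ≡ all (λ l → not (entails f β l) ∨ β l) (allLits n)
  isClosed≡ β = all-cong-∈ (allLits n) λ l∈ → not-xor≡not-∨ (entails-reflexive l∈)

lemma9 : (n : ℕ) → (f : BoolFun n) → IsHornFunction (h f)
lemma9 n f =
  IsHornFunction-∧ {g₁ = isPartial} {g₂ = isClosed f}
    (IsHornFunction-all (allFin n) λ i → IsHornFunction-nand (i , true) (i , false))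
    (IsHornFunction-≗ (sym ∘ isClosed≡ f)
      (IsHornFunction-all (allLits n) λ l →
        IsHornFunction-monotone-implication (≡-dec _≟ᶠ_ _≟ᴮ_) (allLits n) (entails-monotone f l) l))
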